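{- Let $(A_n)_{n=0}^\infty$ be an increasing sequence of finite nonempty alphabets, $A=\bigcup_n A_n$, let $k\in\mathbb{N}$, $E\subseteq W(A)$ and $\vec s=(s_n(x))_{n=0}^\infty\in V^\infty(A)$ be such that $E$ is $k$-large in $\vec s$. Then: (i) $E$ is $k$-large in $\vec t$ for every $\vec t\in V^\infty(A)$ with $\vec t\le_k\vec s$; (ii) for every $m\in\mathbb{N}$, $E$ is $(k+m)$-large in $(s_{m+n}(x))_{n=0}^\infty$.
   Context: $\mathbb{N}=\{0,1,2,\dots\}$. $A_0\subseteq A_1\subseteq\cdots$ are finite nonempty sets (alphabets), $A=\bigcup_{n}A_n$. $W(A)$ is the set of all finite words over $A$ including the empty word; concatenation is juxtaposition. Fix a symbol $x\notin A$. A variable word over $A$ is a word over $A\cup\{x\}$ in which $x$ occurs at least once; $V(A)$ is the set of these, and $V^\infty(A)$ the set of infinite sequences of variable words. For $s(x)\in V(A)$ and $a\in A\cup\{x\}$, $s(a)$ is obtained by replacing each occurrence of $x$ by $a$. For a finite sequence $(s_n(x))_{n=p}^q$ of variable words and finite alphabets $(B_n)_{n=p}^q$ (subsets of $A$), the constant span is $\langle (s_n(x))_{n=p}^q\,\|\,(B_n)_{n=p}^q\rangle_c=\{s_{l_0}(a_0)\cdots s_{l_j}(a_j): j\ge0,\ p\le l_0<\dots<l_j\le q,\ a_i\in B_{l_i}\}$ and the variable span is $\langle (s_n(x))_{n=p}^q\,\|\,(B_n)_{n=p}^q\rangle_v=V(A)\cap\{s_{l_0}(a_0)\cdots s_{l_j}(a_j):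 j\ge0,\ p\le l_0<\dots<l_j\le q,\ a_i\in B_{l_i}\cup\{x\}\}$; for infinite sequences $(s_n(x))_{n=0}^\infty$ with alphabets $(B_n)_{n=0}^\infty$ the spans are defined in the same way with $0\le l_0<\dots<l_j$ arbitrary. For $k\in\mathbb{N}$ and $\vec s=(s_n(x))_{n=0}^\infty\in V^\infty(A)$, a sequence $\vec t=(t_n(x))_{n=0}^\infty\in V^\infty(A)$ is an extracted $k$-subsequence of $\vec s$ (written $\vec t\le_k\vec s$) if for every $l\in\mathbb{N}$ there exist $0=m_0<\dots<m_{l+1}$ with $t_i(x)\in\langle (s_n(x))_{n=m_i}^{m_{i+1}-1}\,\|\,(A_{k+n})_{n=m_i}^{m_{i+1}-1}\rangle_v$ for all $0\le i\le l$. A set $E\subseteq W(A)$ is $k$-large in $\vec s$ if $E\cap\langle\vec w\,\|\,(A_{k+n})_{n=0}^\infty\rangle_c\ne\emptyset$ for every $\vec w\in V^\infty(A)$ with $\vec w\le_k\vec s$. -}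

module Defs where

open import Data.Nat using (ℕ; zero; suc; _+_; _≤_; _<_)
open import Data.List using (List; []; _∷_; _++_; map)
open import Data.List.Membership.Propositional using (_∈_)
open import Data.List.Relation.Unary.All using (All)
open import Data.Maybe using (Maybe; just; nothing; maybe)
open import Data.Product using (Σ; ∃; _×_)
open import Data.Unit using (⊤)
open import Relation.Binary.PropositionalEquality using (_≡_)

-- Letters live in an arbitrary type L; the variable x is `nothing`,
-- a letter a is `just a` (so x ∉ A automatically).

InA : {L : Set} → (ℕ → List L) → L → Set
InA A a = ∃ λ n → a ∈ A n

IsWord : {L : Set} → (ℕ → List L) → List L → Set
IsWord A w = All (InA A) w

IsVarWord : {L : Set} → (ℕ → List L) → List (Maybe L) → Set
IsVarWord A w = (nothing ∈ w) × All (maybe (InA A) ⊤) w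

IsVarSeq : {L : Set} → (ℕ → List L) → (ℕ → List (Maybe L)) → Set
IsVarSeq A s = ∀ n → IsVarWord A (s n)

substC : {L : Set} → List (Maybe L) → L → List L
substC w a = map (maybe (λ b → b) a) w

substV : {L : Set} → List (Maybe L) → Maybe L → List (Maybe L)
substV w c = map (maybe just c) w

data Prods {X Y : Set} (f : ℕ → X → List Y) (ok : ℕ → X → Set)
           (lim : ℕ → Set) : ℕ → List Y → Set where
  one  : ∀ {lo l c} → lo ≤ l → lim l → ok l c → Prods f ok lim lo (f l c)
  more : ∀ {lo l c w} → lo ≤ l → lim l → ok l c →
         Prods f ok lim (suc l) w → Prods f ok lim lo (f l c ++ w)

CSpan : {L : Set} → (ℕ → List (Maybe L)) → (ℕ → List L) →
        ℕ → (ℕ → Set) → List L → Set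
CSpan s B p lim = Prods (λ l a → substC (s l) a) (λ l a → a ∈ B l) lim p

-- variable span ⟨ (s n)_{n ≥ p, lim n} ‖ (B n) ⟩_v  (intersected with V(A))
VSpan : {L : Set} → (ℕ → List L) → (ℕ → List (Maybe L)) → (ℕ → List L) →
        ℕ → (ℕ → Set) → List (Maybe L) → Set
VSpan A s B p lim w =
  IsVarWord A w ×
  Prods (λ l c → substV (s l) c) (λ l c → maybe (λ a → a ∈ B l) ⊤ c) lim p w

ExtSub : {L : Set} → (ℕ → List L) → ℕ →
         (ℕ → List (Maybe L)) → (ℕ → List (Maybe L)) → Set
ExtSub A k t s =
  ∀ l → Σ (ℕ → ℕ) λ m →
    (m 0 ≡ 0) ×
    (∀ i → i ≤ l → m i < m (suc i)) ×
    (∀ i → i ≤ l →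
       VSpan A s (λ n → A (k + n)) (m i) (λ n → n < m (suc i)) (t i))

Large : {L : Set} → (ℕ → List L) → ℕ → (List L → Set) →
        (ℕ → List (Maybe L)) → Set
Large {L} A k E s =
  ∀ (w : ℕ → List (Maybe L)) → IsVarSeq A w → ExtSub A k w s →
    ∃ λ u → E u × CSpan w (λ n → A (k + n)) 0 (λ _ → ⊤) u

module Submission where

open import Defs
open import Data.Nat using (ℕ; suc; _+_)
open import Data.List using (List; [])
open import Data.List.Membership.Propositional using (_∈_)
open import Data.Maybe using (Maybe)
open import Data.Product using (_×_)
open import Relation.Binary.PropositionalEquality using (_≢_)

open import Data.Nat using (zero; _≤_; _<_; _≤′_; ≤′-refl; ≤′-step; z≤n; s≤s; s≤s⁻¹)
open import Data.Nat.Properties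
open import Data.List using (_++_)
open import Data.List.Properties using (map-++; ++-assoc; map-∘; map-cong)
open import Data.Maybe using (just; nothing; maybe; maybe′)
open import Data.Product using (_,_; proj₁; proj₂; map₂)
open import Data.Unit using (⊤; tt)
open import Function using (_∘_; id)
open import Relation.Binary.PropositionalEquality
  using (_≡_; refl; sym; trans; cong; subst; module ≡-Reasoning)

-- Both parts are statements about ≤ₖ alone: (i) is the transitivity of ≤ₖ, and
-- (ii) holds because every (k+m)-extraction of (s_{m+n})ₙ is, after merging the
-- first m words of s into its first block, a k-extraction of s; the alphabets
-- only grow, so every constant span over A_{k+n} is one over A_{k+m+n}.

maybe-⊤-map : ∀ {X : Set} {P Q : X → Set} → (∀ {x} → P x → Q x) →
              ∀ c → maybe P ⊤ c → maybe Q ⊤ c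
maybe-⊤-map P⊆Q nothing  _  = tt
maybe-⊤-map P⊆Q (just x) Px = P⊆Q Px

substV-substV : ∀ {L : Set} (w : List (Maybe L)) d c →
                substV (substV w d) c ≡ substV w (maybe′ just c d)
substV-substV w d c = trans (sym (map-∘ w)) (map-cong letter w)
  where
    letter : ∀ e → maybe′ just c (maybe′ just d e) ≡ maybe′ just (maybe′ just c d) e
    letter nothing  = refl
    letter (just _) = refl

module _ {X Y : Set} {f : ℕ → X → List Y} where

  Prods-mono : ∀ {ok ok′ : ℕ → X → Set} {lim lim′ : ℕ → Set} {lo lo′ w} →
               (∀ {l c} → lim l → ok l c → ok′ l c) → (∀ {l} → lim l → lim′ l) →
               lo′ ≤ lo → Prods f ok lim lo w → Prods f ok′ lim′ lo′ w
  Prods-mono ok⊆ lim⊆ lo′≤lo (one lo≤l lim-l ok-c) =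
    one (≤-trans lo′≤lo lo≤l) (lim⊆ lim-l) (ok⊆ lim-l ok-c)
  Prods-mono ok⊆ lim⊆ lo′≤lo (more lo≤l lim-l ok-c rest) =
    more (≤-trans lo′≤lo lo≤l) (lim⊆ lim-l) (ok⊆ lim-l ok-c) (Prods-mono ok⊆ lim⊆ ≤-refl rest)

  Prods-++ : ∀ {ok : ℕ → X → Set} {lim₁ lim₂ lim : ℕ → Set} {lo lo₂ w₁ w₂} →
             (∀ {l} → lim₁ l → lim l) → (∀ {l} → lim₂ l → lim l) →
             (∀ {l} → lim₁ l → l < lo₂) →
             Prods f ok lim₁ lo w₁ → Prods f ok lim₂ lo₂ w₂ → Prods f ok lim lo (w₁ ++ w₂)
  Prods-++ lim₁⊆ lim₂⊆ below (one lo≤l lim-l ok-c) P₂ =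
    more lo≤l (lim₁⊆ lim-l) ok-c (Prods-mono (λ _ → id) lim₂⊆ (below lim-l) P₂)
  Prods-++ {ok} {lim = lim} {lo} {w₂ = w₂} lim₁⊆ lim₂⊆ below
           (more {l = l} {c} {w} lo≤l lim-l ok-c rest) P₂ =
    subst (Prods f ok lim lo) (sym (++-assoc (f l c) w w₂))
      (more lo≤l (lim₁⊆ lim-l) ok-c (Prods-++ lim₁⊆ lim₂⊆ below rest P₂))

  Prods-shift : ∀ {ok : ℕ → X → Set} {lim : ℕ → Set} (m : ℕ) {lo w} →
                Prods (f ∘ (m +_)) (ok ∘ (m +_)) (lim ∘ (m +_)) lo w → Prods f ok lim (m + lo) w
  Prods-shift m (one lo≤l lim-l ok-c) = one (+-monoʳ-≤ m lo≤l) lim-l ok-c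
  Prods-shift {ok} {lim} m (more {l = l} {w = w} lo≤l lim-l ok-c rest) =
    more (+-monoʳ-≤ m lo≤l) lim-l ok-c
      (subst (λ lo → Prods f ok lim lo w) (+-suc m l) (Prods-shift m rest))

module StrictlyIncreasingUpTo (f : ℕ → ℕ) (N : ℕ) (f-< : ∀ j → j ≤ N → f j < f (suc j)) where

  mono-≤ : ∀ {i j} → i ≤ j → j ≤ suc N → f i ≤ f j
  mono-≤ i≤j = go (≤⇒≤′ i≤j)
    where
      go : ∀ {i j} → i ≤′ j → j ≤ suc N → f i ≤ f j
      go ≤′-refl          _     = ≤-refl
      go (≤′-step {j} i≤j) 1+j≤ = ≤-trans (go i≤j (<⇒≤ 1+j≤)) (<⇒≤ (f-< j (s≤s⁻¹ 1+j≤)))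

  mono-< : ∀ {i j} → i < j → j ≤ suc N → f i < f j
  mono-< i<j j≤ = <-≤-trans (f-< _ (s≤s⁻¹ (≤-trans i<j j≤))) (mono-≤ i<j j≤)

  n≤f[n] : ∀ {j} → j ≤ suc N → j ≤ f j
  n≤f[n] {zero}  _    = z≤n
  n≤f[n] {suc j} 1+j≤ = ≤-trans (s≤s (n≤f[n] (<⇒≤ 1+j≤))) (f-< j (s≤s⁻¹ 1+j≤))

module VariableProducts {L : Set} (B : ℕ → List L)
                        (B-mono : ∀ {i j a} → i ≤ j → a ∈ B i → a ∈ B j) where

  LetterOrVar : ℕ → Maybe L → Set
  LetterOrVar l = maybe (λ a → a ∈ B l) ⊤

  VProds : (ℕ → List (Maybe L)) → (ℕ → Set) → ℕ → List (Maybe L) → Set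
  VProds s = Prods (λ l c → substV (s l) c) LetterOrVar

  LetterOrVar-subst : ∀ {l p c} d → l ≤ p → LetterOrVar l c → LetterOrVar p d →
                      LetterOrVar p (maybe′ just c d)
  LetterOrVar-subst {c = c} nothing l≤p c-ok _ = maybe-⊤-map (B-mono l≤p) c c-ok
  LetterOrVar-subst (just _) _ _ d-ok = d-ok

  VProds-substV : ∀ {s lim lo l c w} → l ≤ lo → LetterOrVar l c →
                  VProds s lim lo w → VProds s lim lo (substV w c)
  VProds-substV {s} {lim} {lo} {c = c} l≤lo c-ok (one {l = p} {d} lo≤p lim-p d-ok) =
    subst (VProds s lim lo) (sym (substV-substV (s p) d c))
      (one lo≤p lim-p (LetterOrVar-subst d (≤-trans l≤lo lo≤p) c-ok d-ok))
  VProds-substV {s} {lim} {lo} {c = c} l≤lo c-ok (more {l = p} {d} {w} lo≤p lim-p d-ok rest) =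
    subst (VProds s lim lo) (sym substituted)
      (more lo≤p lim-p (LetterOrVar-subst d l≤p c-ok d-ok)
            (VProds-substV (≤-trans l≤p (n≤1+n p)) c-ok rest))
    where
      l≤p = ≤-trans l≤lo lo≤p
      open ≡-Reasoning
      substituted : substV (substV (s p) d ++ w) c ≡ substV (s p) (maybe′ just c d) ++ substV w c
      substituted = begin
        substV (substV (s p) d ++ w) c               ≡⟨ map-++ (maybe′ just c) (substV (s p) d) w ⟩
        substV (substV (s p) d) c ++ substV w c      ≡⟨ cong (_++ substV w c) (substV-substV (s p) d c) ⟩
        substV (s p) (maybe′ just c d) ++ substV w c  ∎

  VProds-compose : ∀ {s t : ℕ → List (Maybe L)} {m : ℕ → ℕ} {H : ℕ}
    (m-< : ∀ i → i ≤ H → m i < m (suc i)) →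
    (t-in-s : ∀ i → i ≤ H → VProds s (λ p → p < m (suc i)) (m i) (t i)) →
    ∀ {lo hi w} → hi ≤ suc H → VProds t (λ l → l < hi) lo w → VProds s (λ p → p < m hi) (m lo) w
  VProds-compose {s} {t} {m} {H} m-< t-in-s = go
    where
      open StrictlyIncreasingUpTo m H m-<
      go : ∀ {lo hi w} → hi ≤ suc H → VProds t (λ l → l < hi) lo w → VProds s (λ p → p < m hi) (m lo) w
      word : ∀ {lo hi l c} → hi ≤ suc H → lo ≤ l → l < hi → LetterOrVar l c →
             VProds s (λ p → p < m (suc l)) (m lo) (substV (t l) c)
      word hi≤ lo≤l l<hi c-ok =
        Prods-mono (λ _ → id) id (mono-≤ lo≤l (≤-trans (<⇒≤ l<hi) hi≤))
          (VProds-substV (n≤f[n] (≤-trans (<⇒≤ l<hi) hi≤)) c-ok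
            (t-in-s _ (s≤s⁻¹ (≤-trans l<hi hi≤))))
      inside : ∀ {hi l} → hi ≤ suc H → l < hi → ∀ {p} → p < m (suc l) → p < m hi
      inside hi≤ l<hi p< = <-≤-trans p< (mono-≤ l<hi hi≤)
      go hi≤ (one lo≤l l<hi c-ok) =
        Prods-mono (λ _ → id) (inside hi≤ l<hi) ≤-refl (word hi≤ lo≤l l<hi c-ok)
      go hi≤ (more lo≤l l<hi c-ok rest) =
        Prods-++ (inside hi≤ l<hi) id id (word hi≤ lo≤l l<hi c-ok) (go hi≤ rest)

module _ {L : Set} (A : ℕ → List L) (A-suc : ∀ n {a} → a ∈ A n → a ∈ A (suc n)) where

  A-mono : ∀ {i j a} → i ≤ j → a ∈ A i → a ∈ A j
  A-mono i≤j = go (≤⇒≤′ i≤j)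
    where
      go : ∀ {i j a} → i ≤′ j → a ∈ A i → a ∈ A j
      go ≤′-refl          = id
      go (≤′-step {j} i≤j) = A-suc j ∘ go i≤j

  ExtSub-trans : ∀ k {w t s} → ExtSub A k w t → ExtSub A k t s → ExtSub A k w s
  ExtSub-trans k w≤t t≤s l with w≤t l
  ... | m′ , m′0≡0 , m′-< , w-in-t with t≤s (m′ (suc l))
  ... | m , m0≡0 , m-< , t-in-s =
      m ∘ m′
    , trans (cong m m′0≡0) m0≡0
    , (λ i i≤l → M.mono-< (m′-< i i≤l) (bound i≤l))
    , λ i i≤l → proj₁ (w-in-t i i≤l)
              , VProds-compose m-< (λ j j≤ → proj₂ (t-in-s j j≤)) (bound i≤l) (proj₂ (w-in-t i i≤l))
    where
      open VariableProducts (λ n → A (k + n)) (A-mono ∘ +-monoʳ-≤ k)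
      module M = StrictlyIncreasingUpTo m (m′ (suc l)) m-<
      bound : ∀ {i} → i ≤ l → m′ (suc i) ≤ suc (m′ (suc l))
      bound i≤l = m≤n⇒m≤1+n (StrictlyIncreasingUpTo.mono-≤ m′ l m′-< (s≤s i≤l) ≤-refl)
    
  A-shift : ∀ k m {l a} → a ∈ A ((k + m) + l) → a ∈ A (k + (m + l))
  A-shift k m {l} = A-mono (≤-reflexive (+-assoc k m l))

  -- The new first block [0, m + m′₁) absorbs the m dropped words of s.
  ExtSub-shift : ∀ k m {w s} → ExtSub A (k + m) w (λ n → s (m + n)) → ExtSub A k w s
  ExtSub-shift k m {w} {s} w≤s l with w≤s l
  ... | m′ , m′0≡0 , m′-< , w-in-s = n , refl , n-< , w-in-s′
    where
      n : ℕ → ℕ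
      n zero    = 0
      n (suc i) = m + m′ (suc i)
      n-< : ∀ i → i ≤ l → n i < n (suc i)
      n-< zero    i≤l = <-≤-trans (subst (_< m′ 1) m′0≡0 (m′-< 0 i≤l)) (m≤n+m (m′ 1) m)
      n-< (suc i) i≤l = +-monoʳ-< m (m′-< (suc i) i≤l)
      n≤ : ∀ i → n i ≤ m + m′ i
      n≤ zero    = z≤n
      n≤ (suc i) = ≤-refl
      w-in-s′ : ∀ i → i ≤ l → VSpan A s (λ p → A (k + p)) (n i) (λ p → p < n (suc i)) (w i)
      w-in-s′ i i≤l =
          proj₁ (w-in-s i i≤l)
        , Prods-mono (λ _ → id) id (n≤ i)
            (Prods-shift m (Prods-mono (λ {_} {c} _ → maybe-⊤-map (A-shift k m) c) (+-monoʳ-< m) ≤-refl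
              (proj₂ (w-in-s i i≤l))))

  CSpan-raise : ∀ k m {w u} → CSpan w (λ n → A (k + n)) 0 (λ _ → ⊤) u →
                CSpan w (λ n → A ((k + m) + n)) 0 (λ _ → ⊤) u
  CSpan-raise k m = Prods-mono (λ {l} _ → A-mono (+-monoˡ-≤ l (m≤m+n k m))) id ≤-refl

fact3p4 : {L : Set} (A : ℕ → List L) →
    (∀ n → A n ≢ []) →
    (∀ n {a} → a ∈ A n → a ∈ A (suc n)) →
    (k : ℕ) (E : List L → Set) → (∀ u → E u → IsWord A u) →
    (s : ℕ → List (Maybe L)) → IsVarSeq A s →
    Large A k E s →
      ((t : ℕ → List (Maybe L)) → IsVarSeq A t → ExtSub A k t s → Large A k E t)
      × ((m : ℕ) → Large A (k + m) E (λ n → s (m + n)))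
fact3p4 A _ A-suc k E _ s _ E-large =
    (λ t _ t≤s w w-var w≤t → E-large w w-var (ExtSub-trans A A-suc k w≤t t≤s))
  , λ m w w-var w≤s → map₂ (map₂ (CSpan-raise A A-suc k m))
                            (E-large w w-var (ExtSub-shift A A-suc k m w≤s))
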